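{- Let $K$ be a field of characteristic zero (e.g. $K=\mathbb{C}$ or $\mathbb{C}_p$), $D=\frac{d}{dt}$, $\Delta=tD$. Let $P(x)\in K[x]$ with $\deg P=m\ge 2$, $P(-1)=0$, and $P(k)\neq 0$ for all integers $k\ge 0$, and let $$F(t)=\sum_{n=0}^{\infty}\frac{t^n}{\prod_{k=0}^{n-1}P(k)}.$$ Write $P(x)=(x+1)P_1(x+1)$ with $P_1\in K[x]$. Then $F$ satisfies $[\Delta P_1(\Delta)-t]F=0$, which can be written as $N\Delta^mF=P_1^*\Delta^{m-1}F+\dots+P_m^*\Delta^0F$ with $N\in K\setminus\{0\}$ (so $S=\deg N=0$), $P_j^*\in K$ (so $\deg P_j^*<1$) for $j=1,\dots,m-1$, and $\deg P_m^*=1$. Consequently, for this equation the following holds: for every $(A_{0,1},\dots,A_{0,m})\in K[t]^m\setminus\{(0,\dots,0)\}$, defining $A_{n,j}\in K[t]$ recursively by $$A_{k+1,j}=P_j^*A_{k,1}+N\,\Delta A_{k,j}+NA_{k,j+1}\ (j=1,\dots,m-1),\qquad A_{k+1,m}=P_m^*A_{k,1}+N\,\Delta A_{k,m},$$ the determinants $\det\big(A_{k+i-1,j}\big)_{1\le i,j\le m}$ are nonzero for all $k\in\mathbb{N}$.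
   Context: The $A_{n,j}$ are the coefficients of the linear forms $L_n=(N\Delta)^nL_0=A_{n,1}\Delta^{m-1}F+\dots+A_{n,m}\Delta^0F$ with $L_0=A_{0,1}\Delta^{m-1}F+\dots+A_{0,m}\Delta^0F$, obtained using the differential equation to eliminate $\Delta^mF$. $\mathbb{N}$ includes $0$. -}

module Defs where

open import Level using (Level; _⊔_)
open import Data.Nat as ℕ using (ℕ; zero; suc; _∸_; _<ᵇ_)
open import Data.Nat.Properties using (_<?_)
open import Data.Fin using (Fin; zero; suc; toℕ; punchIn; fromℕ<)
open import Data.Bool using (if_then_else_)
open import Data.Product using (∃)
open import Relation.Nullary using (¬_; yes; no)
open import Algebra.Bundles using (CommutativeRing)
open import Algebra.Bundles.Raw using (RawRing)

record Field (c ℓ : Level) : Set (Level.suc (c ⊔ ℓ)) where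
  field
    commRing : CommutativeRing c ℓ
  open CommutativeRing commRing public
  field
    1≉0     : ¬ (1# ≈ 0#)
    inverse : ∀ x → ¬ (x ≈ 0#) → ∃ λ y → x * y ≈ 1#

module Det {c ℓ : Level} (R : RawRing c ℓ) where
  open RawRing R

  alt : ℕ → Carrier → Carrier
  alt zero    x = x
  alt (suc k) x = - alt k x

  sumFin : ∀ n → (Fin n → Carrier) → Carrier
  sumFin zero    f = 0#
  sumFin (suc n) f = f zero + sumFin n (λ i → f (suc i))

  det : ∀ n → (Fin n → Fin n → Carrier) → Carrier
  det zero    M = 1#
  det (suc n) M =
    sumFin (suc n) (λ j →
      alt (toℕ j) (M zero j * det n (λ i k → M (suc i) (punchIn j k))))

module Over {c ℓ : Level} (K : Field c ℓ) where
  open Field K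

  ι : ℕ → Carrier
  ι zero    = 0#
  ι (suc n) = 1# + ι n

  CharZero : Set ℓ
  CharZero = ∀ n → ¬ (ι (suc n) ≈ 0#)

  Σ< : ℕ → (ℕ → Carrier) → Carrier
  Σ< zero    f = 0#
  Σ< (suc n) f = Σ< n f + f n

  Π< : ℕ → (ℕ → Carrier) → Carrier
  Π< zero    f = 1#
  Π< (suc n) f = Π< n f * f n

  pow : Carrier → ℕ → Carrier
  pow x zero    = 1#
  pow x (suc n) = pow x n * x

  eval : ℕ → (ℕ → Carrier) → Carrier → Carrier
  eval d a x = Σ< d (λ i → a i * pow x i)

  -- Formal power series K[[t]] as coefficient sequences.  Polynomials
  -- K[t] are the series with finitely many nonzero coefficients.

  Series : Set c
  Series = ℕ → Carrier

  _≈ₛ_ : Series → Series → Set ℓ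
  a ≈ₛ b = ∀ n → a n ≈ b n

  IsPoly : Series → Set ℓ
  IsPoly a = ∃ λ d → ∀ n → d ℕ.≤ n → a n ≈ 0#

  0ₛ : Series
  0ₛ n = 0#

  constₛ : Carrier → Series
  constₛ x zero    = x
  constₛ x (suc n) = 0#

  1ₛ : Series
  1ₛ = constₛ 1#

  tₛ : Series
  tₛ zero          = 0#
  tₛ (suc zero)    = 1#
  tₛ (suc (suc n)) = 0#

  infixl 6 _+ₛ_
  infixl 7 _*ₛ_ _·ₛ_
  infix 4 _≈ₛ_

  _+ₛ_ : Series → Series → Series
  (a +ₛ b) n = a n + b n

  -ₛ_ : Series → Series
  (-ₛ a) n = - a n

  _*ₛ_ : Series → Series → Series
  (a *ₛ b) n = Σ< (suc n) (λ i → a i * b (n ∸ i))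

  _·ₛ_ : Carrier → Series → Series
  (x ·ₛ a) n = x * a n

  powₛ : Series → ℕ → Series
  powₛ a zero    = 1ₛ
  powₛ a (suc n) = powₛ a n *ₛ a

  Σₛ< : ℕ → (ℕ → Series) → Series
  Σₛ< d f n = Σ< d (λ i → f i n)

  seriesRing : RawRing c ℓ
  seriesRing = record
    { Carrier = Series ; _≈_ = _≈ₛ_ ; _+_ = _+ₛ_ ; _*_ = _*ₛ_
    ; -_ = -ₛ_ ; 0# = 0ₛ ; 1# = 1ₛ }

  detₛ : ∀ n → (Fin n → Fin n → Series) → Series
  detₛ = Det.det seriesRing

  -- Δ = t d/dt acting on K[[t]]:  Σ a_n t^n ↦ Σ n a_n t^n
  Δ : Series → Series
  Δ a n = ι n * a n

  Δ^ : ℕ → Series → Series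
  Δ^ zero    a = a
  Δ^ (suc k) a = Δ (Δ^ k a)

  -- The data of the equation, computed from P₁ (coefficients q, of
  -- degree ≤ m-1) where  P(x) = (x+1) P₁(x+1).
  -- [Δ P₁(Δ) - t] F = 0  is rewritten as
  --   N Δ^m F = P₁* Δ^{m-1} F + … + P_m* Δ^0 F
  -- with N = q_{m-1}, P_j* = - q_{m-1-j} (j = 1,…,m-1), P_m* = t.
  -- Indices j are 0-based below: index j ↔ paper's j+1.

  module Eq (m : ℕ) (q : ℕ → Carrier) where

    N : Carrier
    N = q (m ∸ 1)

    Pstar : ℕ → Series
    Pstar j = if suc j <ᵇ m then constₛ (- q (m ∸ 2 ∸ j)) else tₛ

    P₁Δ : Series → Series
    P₁Δ F = Σₛ< m (λ i → q i ·ₛ Δ^ i F)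

    rhs : Series → Series
    rhs F = Σₛ< m (λ j → Pstar j *ₛ Δ^ (m ∸ 1 ∸ j) F)

    -- the recursion for A_{k,j}; A k j is the paper's A_{k,j+1}
    A : (Fin m → Series) → ℕ → ℕ → Series
    A A₀ zero j n with j <? m
    ... | yes j<m = A₀ (fromℕ< j<m) n
    ... | no  _   = 0#
    A A₀ (suc k) j =
      if suc j <ᵇ m
      then (Pstar j *ₛ A A₀ k 0) +ₛ (N ·ₛ Δ (A A₀ k j)) +ₛ (N ·ₛ A A₀ k (suc j))
      else (Pstar j *ₛ A A₀ k 0) +ₛ (N ·ₛ Δ (A A₀ k j))

    M : (Fin m → Series) → ℕ → Fin m → Fin m → Series
    M A₀ k i j = A A₀ (k ℕ.+ toℕ i) (toℕ j)

{-# OPTIONS --safe #-}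
module Submission where

-- The first three claims are coefficientwise: P(n − 1) = n P₁(n) turns the recursion
-- F(n − 1) = P(n − 1) F(n) into [Δ P₁(Δ) − t] F = 0, and N = q_{m−1} = p_m ≠ 0.
--
-- For the determinants, give tⁿ in the entry A_{k,j} (0-based j < m) the weight
-- m n + (m − 1 − j); these weights enumerate ℕ, each exactly once.  In the recursion the
-- constants P_j^* and Δ never raise the weight, while A_{k,j+1} ↦ N A_{k+1,j} and
-- A_{k,0} ↦ t A_{k+1,m−1} raise it by exactly one.  So if the row A_k has weighted degree E
-- with nonzero leading coefficient, A_{k+1} has weighted degree E + 1 with leading
-- coefficient multiplied by N or 1.  The rows k, …, k + m − 1 of the matrix then have their
-- leading terms in m distinct columns, so the top weighted coefficient of the determinant is
-- ± a product of these leading coefficients, hence nonzero.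

open import Level using (Level)
open import Data.Bool using (true; false)
open import Data.Empty using (⊥-elim)
open import Data.Fin as Fin using (Fin; toℕ; punchIn; punchOut; fromℕ<)
import Data.Fin.Properties as Fin
import Data.Nat.Properties as ℕ
open import Data.Nat as ℕ
  using (ℕ; zero; suc; z≤n; s≤s; _≤_; _<_; _∸_; _<ᵇ_; NonZero)
  renaming (_+_ to _+ℕ_; _*_ to _*ℕ_)
open import Data.Product using (∃; _×_; _,_; proj₁; proj₂)
open import Data.Sum using (_⊎_; inj₁; inj₂)
open import Function using (_∘_; case_of_)
open import Function.Definitions using (Injective)
open import Data.Nat.Divisibility using (divides; _∣?_)
open import Relation.Nullary using (¬_; yes; no; Dec)
open import Relation.Binary.PropositionalEquality as ≡ using (_≡_; _≢_)

open import Algebra.Properties.CommutativeMonoid.Sum ℕ.+-0-commutativeMonoid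
  using (sum; sum-remove)
open import Data.Vec.Functional using (removeAt)

open import Defs

<ᵇ-true : ∀ {i j} → i < j → (i <ᵇ j) ≡ true
<ᵇ-true {zero}  {suc j} _         = ≡.refl
<ᵇ-true {suc i} {suc j} (s≤s i<j) = <ᵇ-true i<j

<ᵇ-irrefl : ∀ n → (n <ᵇ n) ≡ false
<ᵇ-irrefl zero    = ≡.refl
<ᵇ-irrefl (suc n) = <ᵇ-irrefl n

module WeightArithmetic where
  open import Data.Nat using (_+_; _*_; _%_)
  open import Data.Nat.DivMod using ([m+kn]%n≡m%n; m<n⇒m%n≡m)
  open import Data.Nat.Tactic.RingSolver using (solve-∀)
  open import Algebra.Properties.CommutativeSemigroup ℕ.+-commutativeSemigroup
    using (interchange; xy∙z≈xz∙y)
  open ≡.≡-Reasoning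

  weight-+ : ∀ w n n′ s s′ → w * (n + n′) + (s + s′) ≡ (w * n + s) + (w * n′ + s′)
  weight-+ = solve-∀

  weight-split : ∀ w s s′ {i D} → i ≤ D → w * D + (s + s′) ≡ (w * i + s) + (w * (D ∸ i) + s′)
  weight-split w s s′ {i} {D} i≤D = begin
    w * D + (s + s′)                  ≡⟨ ≡.cong (λ d → w * d + (s + s′)) (ℕ.m+[n∸m]≡n i≤D) ⟨
    w * (i + (D ∸ i)) + (s + s′)      ≡⟨ weight-+ w i (D ∸ i) s s′ ⟩
    (w * i + s) + (w * (D ∸ i) + s′)  ∎

  +-cancel-<ʳ : ∀ {a b X Y} → X ≤ a → a + b < X + Y → b < Y
  +-cancel-<ʳ X≤a a+b<X+Y = ℕ.≰⇒> λ Y≤b → ℕ.<⇒≱ a+b<X+Y (ℕ.+-mono-≤ X≤a Y≤b)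

  *+-remainder : ∀ w .{{_ : NonZero w}} n {r} → r < w → (w * n + r) % w ≡ r
  *+-remainder w n {r} r<w = begin
    (w * n + r) % w  ≡⟨ ≡.cong (_% w) (≡.trans (ℕ.+-comm (w * n) r) (≡.cong (r +_) (ℕ.*-comm w n))) ⟩
    (r + n * w) % w  ≡⟨ [m+kn]%n≡m%n r n w ⟩
    r % w            ≡⟨ m<n⇒m%n≡m r<w ⟩
    r                ∎

  *+-injective : ∀ w .{{_ : NonZero w}} {n n′ r r′} → r < w → r′ < w →
                 w * n + r ≡ w * n′ + r′ → n ≡ n′ × r ≡ r′
  *+-injective w {n} {n′} {r} {r′} r<w r′<w eq = n≡n′ , r≡r′
    where
    r≡r′ : r ≡ r′
    r≡r′ = ≡.trans (≡.sym (*+-remainder w n r<w))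
             (≡.trans (≡.cong (_% w) eq) (*+-remainder w n′ r′<w))
    n≡n′ : n ≡ n′
    n≡n′ = ℕ.*-cancelˡ-≡ n n′ w (ℕ.+-cancelʳ-≡ r _ _ (≡.trans eq (≡.cong (w * n′ +_) (≡.sym r≡r′))))

  sum-+ˡ : ∀ k E (f : Fin k → ℕ) → sum (λ i → E + f i) ≡ k * E + sum f
  sum-+ˡ zero    E f = ≡.refl
  sum-+ˡ (suc k) E f = ≡.trans (≡.cong (E + f Fin.zero +_) (sum-+ˡ k E (f ∘ Fin.suc)))
                              (interchange E (f Fin.zero) (k * E) (sum (f ∘ Fin.suc)))

  ≤-sum : ∀ {k} (f : Fin k → ℕ) j → f j ≤ sum f
  ≤-sum f Fin.zero    = ℕ.m≤m+n _ _
  ≤-sum f (Fin.suc j) = ℕ.≤-trans (≤-sum (f ∘ Fin.suc) j) (ℕ.m≤n+m _ _)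

  sum-reverse : ∀ n → sum (λ (j : Fin (suc n)) → n ∸ toℕ j) ≡ sum (toℕ {suc n})
  sum-reverse zero    = ≡.refl
  sum-reverse (suc n) = begin
    suc n + sum (λ (j : Fin (suc n)) → n ∸ toℕ j)  ≡⟨ ≡.cong (suc n +_) (sum-reverse n) ⟩
    suc n + sum (toℕ {suc n})                       ≡⟨ ≡.cong (_+ sum (toℕ {suc n})) (ℕ.*-identityʳ (suc n)) ⟨
    suc n * 1 + sum (toℕ {suc n})                   ≡⟨ sum-+ˡ (suc n) 1 toℕ ⟨
    sum (λ (j : Fin (suc n)) → suc (toℕ j))         ∎

open WeightArithmetic

module FieldProperties {c ℓ : Level} (K : Field c ℓ) where
  open Field K
  open import Algebra.Properties.AbelianGroup +-abelianGroup
    using (ε⁻¹≈ε; ⁻¹-involutive)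
  open import Relation.Binary.Reasoning.Setoid setoid

  -‿≉0 : ∀ {x} → ¬ (x ≈ 0#) → ¬ (- x ≈ 0#)
  -‿≉0 {x} x≉0 -x≈0 = x≉0 (trans (sym (⁻¹-involutive x)) (trans (-‿cong -x≈0) ε⁻¹≈ε))

  x≈0∧y≈0⇒x+y≈0 : ∀ {x y} → x ≈ 0# → y ≈ 0# → x + y ≈ 0#
  x≈0∧y≈0⇒x+y≈0 x≈0 y≈0 = trans (+-cong x≈0 y≈0) (+-identityʳ 0#)

  y≈0⇒x*y≈0 : ∀ x {y} → y ≈ 0# → x * y ≈ 0#
  y≈0⇒x*y≈0 x y≈0 = trans (*-congˡ y≈0) (zeroʳ x)

  *-≉0 : ∀ {x y} → ¬ (x ≈ 0#) → ¬ (y ≈ 0#) → ¬ (x * y ≈ 0#)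
  *-≉0 {x} {y} x≉0 y≉0 xy≈0 with inverse x x≉0
  ... | x⁻¹ , xx⁻¹≈1 = y≉0 (begin
    y               ≈⟨ *-identityˡ y ⟨
    1# * y          ≈⟨ *-congʳ (trans (sym xx⁻¹≈1) (*-comm x x⁻¹)) ⟩
    (x⁻¹ * x) * y   ≈⟨ *-assoc x⁻¹ x y ⟩
    x⁻¹ * (x * y)   ≈⟨ *-congˡ xy≈0 ⟩
    x⁻¹ * 0#        ≈⟨ zeroʳ x⁻¹ ⟩
    0#              ∎)

module Sums {c ℓ : Level} (K : Field c ℓ) where
  open Field K
  open Over K
  open import Algebra.Properties.AbelianGroup +-abelianGroup using (ε⁻¹≈ε; ⁻¹-∙-comm)
  open import Algebra.Properties.CommutativeSemigroup +-commutativeSemigroup using (interchange)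
  open import Relation.Binary.Reasoning.Setoid setoid

  Σ<-cong : ∀ n {f g : ℕ → Carrier} → (∀ i → i < n → f i ≈ g i) → Σ< n f ≈ Σ< n g
  Σ<-cong zero    f≈g = refl
  Σ<-cong (suc n) f≈g = +-cong (Σ<-cong n (λ i i<n → f≈g i (ℕ.m<n⇒m<1+n i<n))) (f≈g n ℕ.≤-refl)

  Σ<-zero : ∀ n {f : ℕ → Carrier} → (∀ i → i < n → f i ≈ 0#) → Σ< n f ≈ 0#
  Σ<-zero zero    f≈0 = refl
  Σ<-zero (suc n) f≈0 =
    trans (+-cong (Σ<-zero n λ i i<n → f≈0 i (ℕ.m<n⇒m<1+n i<n)) (f≈0 n ℕ.≤-refl)) (+-identityʳ 0#)

  Σ<-single : ∀ n {f : ℕ → Carrier} i₀ → i₀ < n → (∀ i → i < n → i ≢ i₀ → f i ≈ 0#) → Σ< n f ≈ f i₀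
  Σ<-single (suc n) i₀ i₀<1+n f≈0 with n ℕ.≟ i₀
  ... | yes ≡.refl = trans (+-congʳ (Σ<-zero n λ i i<n → f≈0 i (ℕ.m<n⇒m<1+n i<n) (ℕ.<⇒≢ i<n)))
                           (+-identityˡ _)
  ... | no n≢i₀    = trans (+-cong (Σ<-single n i₀ (ℕ.≤∧≢⇒< (ℕ.≤-pred i₀<1+n) (n≢i₀ ∘ ≡.sym))
                                      (λ i i<n → f≈0 i (ℕ.m<n⇒m<1+n i<n)))
                                   (f≈0 n ℕ.≤-refl n≢i₀))
                           (+-identityʳ _)

  Σ<-distrib-+ : ∀ n (f g : ℕ → Carrier) → Σ< n (λ i → f i + g i) ≈ Σ< n f + Σ< n g
  Σ<-distrib-+ zero    f g = sym (+-identityˡ 0#)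
  Σ<-distrib-+ (suc n) f g = trans (+-congʳ (Σ<-distrib-+ n f g)) (interchange _ _ _ _)

  *-distribˡ-Σ< : ∀ n x (f : ℕ → Carrier) → x * Σ< n f ≈ Σ< n (λ i → x * f i)
  *-distribˡ-Σ< zero    x f = zeroʳ x
  *-distribˡ-Σ< (suc n) x f = trans (distribˡ x _ _) (+-congʳ (*-distribˡ-Σ< n x f))

  *-distribʳ-Σ< : ∀ n x (f : ℕ → Carrier) → Σ< n f * x ≈ Σ< n (λ i → f i * x)
  *-distribʳ-Σ< n x f =
    trans (*-comm _ x) (trans (*-distribˡ-Σ< n x f) (Σ<-cong n λ i _ → *-comm x (f i)))

  -‿distrib-Σ< : ∀ n (f : ℕ → Carrier) → - Σ< n f ≈ Σ< n (λ i → - f i)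
  -‿distrib-Σ< zero    f = ε⁻¹≈ε
  -‿distrib-Σ< (suc n) f = trans (sym (⁻¹-∙-comm _ _)) (+-congʳ (-‿distrib-Σ< n f))

  Σ<-suc-head : ∀ n (f : ℕ → Carrier) → Σ< (suc n) f ≈ f 0 + Σ< n (f ∘ suc)
  Σ<-suc-head zero    f = trans (+-identityˡ _) (sym (+-identityʳ _))
  Σ<-suc-head (suc n) f = trans (+-congʳ (Σ<-suc-head n f)) (+-assoc _ _ _)

  Σ<-reverse : ∀ n (f : ℕ → Carrier) → Σ< (suc n) f ≈ Σ< (suc n) (λ i → f (n ∸ i))
  Σ<-reverse zero    f = refl
  Σ<-reverse (suc n) f = begin
    Σ< (suc n) f + f (suc n)                  ≈⟨ +-comm _ _ ⟩
    f (suc n) + Σ< (suc n) f                  ≈⟨ +-congˡ (Σ<-reverse n f) ⟩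
    f (suc n) + Σ< (suc n) (λ i → f (n ∸ i))  ≈⟨ Σ<-suc-head (suc n) (λ i → f (suc n ∸ i)) ⟨
    Σ< (suc (suc n)) (λ i → f (suc n ∸ i))    ∎

  Σ<-comm : ∀ a b (f : ℕ → ℕ → Carrier) →
            Σ< a (λ n → Σ< b (λ i → f i n)) ≈ Σ< b (λ i → Σ< a (λ n → f i n))
  Σ<-comm zero    b f = sym (Σ<-zero b λ _ _ → refl)
  Σ<-comm (suc a) b f = trans (+-congʳ (Σ<-comm a b f)) (sym (Σ<-distrib-+ b _ _))

module SeriesProperties {c ℓ : Level} (K : Field c ℓ) where
  open Field K
  open Over K
  open Sums K
  open FieldProperties K

  *ₛ-coeff≈0 : ∀ (x y : Series) D → (∀ i → i ≤ D → x i * y (D ∸ i) ≈ 0#) → (x *ₛ y) D ≈ 0#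
  *ₛ-coeff≈0 x y D term≈0 = Σ<-zero (suc D) λ i i<1+D → term≈0 i (ℕ.≤-pred i<1+D)

  *ₛ-comm : ∀ x y → x *ₛ y ≈ₛ y *ₛ x
  *ₛ-comm x y n = trans (Σ<-reverse n (λ i → x i * y (n ∸ i)))
    (Σ<-cong (suc n) λ i i<1+n →
      trans (*-congˡ (reflexive (≡.cong y (ℕ.m∸[m∸n]≡n (ℕ.≤-pred i<1+n))))) (*-comm _ _))

  *ₛ-distribʳ-+ₛ : ∀ x y z → (x +ₛ y) *ₛ z ≈ₛ x *ₛ z +ₛ y *ₛ z
  *ₛ-distribʳ-+ₛ x y z n = trans (Σ<-cong (suc n) λ i _ → distribʳ _ _ _) (Σ<-distrib-+ (suc n) _ _)

  Δ^-coeff : ∀ i a n → Δ^ i a n ≈ pow (ι n) i * a n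
  Δ^-coeff zero    a n = sym (*-identityˡ _)
  Δ^-coeff (suc i) a n = trans (*-congˡ (Δ^-coeff i a n)) (trans (sym (*-assoc _ _ _)) (*-congʳ (*-comm _ _)))

  constₛ-*ₛ : ∀ a y → constₛ a *ₛ y ≈ₛ a ·ₛ y
  constₛ-*ₛ a y n = Σ<-single (suc n) 0 (s≤s z≤n) λ where
    zero    _ 0≢0 → ⊥-elim (0≢0 ≡.refl)
    (suc i) _ _   → zeroˡ _

  tₛ-*ₛ-zero : ∀ y → (tₛ *ₛ y) 0 ≈ 0#
  tₛ-*ₛ-zero y = trans (+-identityˡ _) (zeroˡ _)

  tₛ-*ₛ-suc : ∀ y n → (tₛ *ₛ y) (suc n) ≈ y n
  tₛ-*ₛ-suc y n = trans (Σ<-single (suc (suc n)) 1 (s≤s (s≤s z≤n)) λ where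
      zero          _ _   → zeroˡ _
      (suc zero)    _ 1≢1 → ⊥-elim (1≢1 ≡.refl)
      (suc (suc i)) _ _   → zeroˡ _)
    (*-identityˡ _)

module Determinants {c ℓ : Level} (K : Field c ℓ) where
  open Field K
  open Over K
  open FieldProperties K
  open Det rawRing using (alt; sumFin; det)
  private module DetₛS = Det seriesRing
  open import Algebra.Properties.AbelianGroup +-abelianGroup using (ε⁻¹≈ε)

  minor : ∀ {k} {A : Set c} → (Fin (suc k) → Fin (suc k) → A) → Fin (suc k) → Fin k → Fin k → A
  minor M j i l = M (Fin.suc i) (punchIn j l)

  sumFin-cong : ∀ k {f g : Fin k → Carrier} → (∀ j → f j ≈ g j) → sumFin k f ≈ sumFin k g
  sumFin-cong zero    f≈g = refl
  sumFin-cong (suc k) f≈g = +-cong (f≈g Fin.zero) (sumFin-cong k (f≈g ∘ Fin.suc))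

  sumFin-zero : ∀ k {f : Fin k → Carrier} → (∀ j → f j ≈ 0#) → sumFin k f ≈ 0#
  sumFin-zero zero    f≈0 = refl
  sumFin-zero (suc k) f≈0 = trans (+-cong (f≈0 Fin.zero) (sumFin-zero k (f≈0 ∘ Fin.suc))) (+-identityˡ 0#)

  sumFin-single : ∀ k {f : Fin k → Carrier} j₀ → (∀ j → j ≢ j₀ → f j ≈ 0#) → sumFin k f ≈ f j₀
  sumFin-single (suc k) Fin.zero f≈0 =
    trans (+-congˡ (sumFin-zero k λ j → f≈0 (Fin.suc j) λ ())) (+-identityʳ _)
  sumFin-single (suc k) (Fin.suc j₀) f≈0 =
    trans (+-cong (f≈0 Fin.zero λ ())
                  (sumFin-single k j₀ λ j j≢j₀ → f≈0 (Fin.suc j) (j≢j₀ ∘ Fin.suc-injective)))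
          (+-identityˡ _)

  alt-cong : ∀ k {x y} → x ≈ y → alt k x ≈ alt k y
  alt-cong zero    x≈y = x≈y
  alt-cong (suc k) x≈y = -‿cong (alt-cong k x≈y)

  alt-zero : ∀ k {x} → x ≈ 0# → alt k x ≈ 0#
  alt-zero zero    x≈0 = x≈0
  alt-zero (suc k) x≈0 = trans (-‿cong (alt-zero k x≈0)) ε⁻¹≈ε

  alt-≉0 : ∀ k {x} → ¬ (x ≈ 0#) → ¬ (alt k x ≈ 0#)
  alt-≉0 zero    x≉0 = x≉0
  alt-≉0 (suc k) x≉0 = -‿≉0 (alt-≉0 k x≉0)

  detₛ-suc-coeff : ∀ k (M : Fin (suc k) → Fin (suc k) → Series) D →
    detₛ (suc k) M D ≈ sumFin (suc k) (λ j → alt (toℕ j) ((M Fin.zero j *ₛ detₛ k (minor M j)) D))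
  detₛ-suc-coeff k M D = trans (reflexive (sumFin-coeff (suc k) term))
                                (sumFin-cong (suc k) λ j → reflexive (alt-coeff (toℕ j) (expansion j)))
    where
    expansion : Fin (suc k) → Series
    expansion j = M Fin.zero j *ₛ detₛ k (minor M j)
    term : Fin (suc k) → Series
    term j = DetₛS.alt (toℕ j) (expansion j)
    sumFin-coeff : ∀ k (f : Fin k → Series) → DetₛS.sumFin k f D ≡ sumFin k (λ j → f j D)
    sumFin-coeff zero    f = ≡.refl
    sumFin-coeff (suc k) f = ≡.cong (f Fin.zero D +_) (sumFin-coeff k (f ∘ Fin.suc))
    alt-coeff : ∀ k (x : Series) → DetₛS.alt k x D ≡ alt k (x D)
    alt-coeff zero    x = ≡.refl
    alt-coeff (suc k) x = ≡.cong -_ (alt-coeff k x)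

  det-monomial≉0 : ∀ k (L : Fin k → Fin k → Carrier) (π : Fin k → Fin k) → Injective _≡_ _≡_ π →
    (∀ i j → j ≢ π i → L i j ≈ 0#) → (∀ i → ¬ (L i (π i) ≈ 0#)) → ¬ (det k L ≈ 0#)
  det-monomial≉0 zero    L π π-inj L≈0 L≉0 = 1≉0
  det-monomial≉0 (suc k) L π π-inj L≈0 L≉0 det≈0 =
    alt-≉0 (toℕ j₀) (*-≉0 (L≉0 Fin.zero) (det-monomial≉0 k (minor L j₀) π′ π′-inj L′≈0 L′≉0))
      (trans (sym expand) det≈0)
    where
    j₀ : Fin (suc k)
    j₀ = π Fin.zero
    j₀≢ : ∀ i → j₀ ≢ π (Fin.suc i)
    j₀≢ i eq with π-inj eq
    ... | ()
    π′ : Fin k → Fin k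
    π′ i = punchOut (j₀≢ i)
    π′-inj : Injective _≡_ _≡_ π′
    π′-inj eq = Fin.suc-injective (π-inj (Fin.punchOut-injective (j₀≢ _) (j₀≢ _) eq))
    punchIn-π′ : ∀ i → punchIn j₀ (π′ i) ≡ π (Fin.suc i)
    punchIn-π′ i = Fin.punchIn-punchOut (j₀≢ i)
    L′≈0 : ∀ i l → l ≢ π′ i → minor L j₀ i l ≈ 0#
    L′≈0 i l l≢ = L≈0 (Fin.suc i) (punchIn j₀ l) λ eq →
      l≢ (Fin.punchIn-injective j₀ l (π′ i) (≡.trans eq (≡.sym (punchIn-π′ i))))
    L′≉0 : ∀ i → ¬ (minor L j₀ i (π′ i) ≈ 0#)
    L′≉0 i = ≡.subst (λ l → ¬ (L (Fin.suc i) l ≈ 0#)) (≡.sym (punchIn-π′ i)) (L≉0 (Fin.suc i))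
    expand : det (suc k) L ≈ alt (toℕ j₀) (L Fin.zero j₀ * det k (minor L j₀))
    expand = sumFin-single (suc k) j₀ λ j j≢j₀ →
      alt-zero (toℕ j) (trans (*-congʳ (L≈0 Fin.zero j j≢j₀)) (zeroˡ (det k (minor L j))))

module Weighted {c ℓ : Level} (K : Field c ℓ) (w : ℕ) .{{_ : NonZero w}} where
  open Field K
  open Over K
  open Sums K
  open FieldProperties K
  open SeriesProperties K
  open Determinants K
  open Det rawRing using (det)

  -- The coefficient of tⁿ in a series placed at shift s has weight w * n + s.
  DegreeAtMost : ℕ → Series → ℕ → Set ℓ
  DegreeAtMost s x d = ∀ n → d < w *ℕ n +ℕ s → x n ≈ 0#

  CoeffOfWeight : ℕ → Series → ℕ → Carrier → Set ℓ
  CoeffOfWeight s x d l =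
    (∀ n → w *ℕ n +ℕ s ≡ d → x n ≈ l) × ((∀ n → w *ℕ n +ℕ s ≢ d) → l ≈ 0#)

  weight-injective : ∀ {n n′} s → w *ℕ n +ℕ s ≡ w *ℕ n′ +ℕ s → n ≡ n′
  weight-injective {n} {n′} s eq = ℕ.*-cancelˡ-≡ n n′ w (ℕ.+-cancelʳ-≡ s _ _ eq)

  weight? : ∀ s d → (∃ λ n → w *ℕ n +ℕ s ≡ d) ⊎ (∀ n → w *ℕ n +ℕ s ≢ d)
  weight? s d with s ℕ.≤? d | w ∣? (d ∸ s)
  ... | no s≰d | _ = inj₂ λ n eq → s≰d (≡.subst (s ≤_) eq (ℕ.m≤n+m s (w *ℕ n)))
  ... | yes s≤d | yes (divides q d∸s≡qw) =
    inj₁ (q , ≡.trans (≡.cong (_+ℕ s) (≡.trans (ℕ.*-comm w q) (≡.sym d∸s≡qw))) (ℕ.m∸n+n≡m s≤d))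
  ... | yes s≤d | no w∤d∸s = inj₂ λ n eq →
    w∤d∸s (divides n (≡.trans (≡.cong (_∸ s) (≡.sym eq)) (≡.trans (ℕ.m+n∸n≡m (w *ℕ n) s) (ℕ.*-comm w n))))

  module _ {x y : Series} {s s′ a b : ℕ} (x≤a : DegreeAtMost s x a) (y≤b : DegreeAtMost s′ y b) where

    private
      total : ℕ → ℕ
      total D = w *ℕ D +ℕ (s +ℕ s′)

    -- If neither factor vanished, their weights would be at most a and b while adding up to total D.
    *ₛ-term≈0 : ∀ {D i} → i ≤ D → a +ℕ b ≤ total D →
                a +ℕ b < total D ⊎ w *ℕ i +ℕ s ≢ a → x i * y (D ∸ i) ≈ 0#
    *ₛ-term≈0 {D} {i} i≤D ab≤T strict with a ℕ.<? w *ℕ i +ℕ s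
    ... | yes a<X = trans (*-congʳ (x≤a i a<X)) (zeroˡ _)
    ... | no  a≮X = trans (*-congˡ (y≤b (D ∸ i) b<Y)) (zeroʳ _)
      where
      X≤a : w *ℕ i +ℕ s ≤ a
      X≤a = ℕ.≮⇒≥ a≮X
      split : total D ≡ (w *ℕ i +ℕ s) +ℕ (w *ℕ (D ∸ i) +ℕ s′)
      split = weight-split w s s′ i≤D
      b<Y : b < w *ℕ (D ∸ i) +ℕ s′
      b<Y = case strict of λ where
        (inj₁ ab<T) → +-cancel-<ʳ X≤a (≡.subst (a +ℕ b <_) split ab<T)
        (inj₂ X≢a)  → +-cancel-<ʳ (ℕ.≤∧≢⇒< X≤a X≢a) (s≤s (≡.subst (a +ℕ b ≤_) split ab≤T))

    *ₛ-degreeAtMost : DegreeAtMost (s +ℕ s′) (x *ₛ y) (a +ℕ b)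
    *ₛ-degreeAtMost D ab<T = *ₛ-coeff≈0 x y D λ i i≤D → *ₛ-term≈0 i≤D (ℕ.<⇒≤ ab<T) (inj₁ ab<T)

    *ₛ-gap : ∀ D → (∀ n → w *ℕ n +ℕ s ≢ a) → a +ℕ b ≤ total D → (x *ₛ y) D ≈ 0#
    *ₛ-gap D no-weight ab≤T = *ₛ-coeff≈0 x y D λ i i≤D → *ₛ-term≈0 i≤D ab≤T (inj₂ (no-weight i))

    *ₛ-leading : ∀ {n n′} → w *ℕ n +ℕ s ≡ a → w *ℕ n′ +ℕ s′ ≡ b → (x *ₛ y) (n +ℕ n′) ≈ x n * y n′
    *ₛ-leading {n} {n′} wn≡a wn′≡b =
      trans (Σ<-single (suc (n +ℕ n′)) n (s≤s (ℕ.m≤m+n n n′)) λ i i<1+D i≢n →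
               *ₛ-term≈0 (ℕ.≤-pred i<1+D) (ℕ.≤-reflexive (≡.sym T≡ab))
                 (inj₂ λ wi≡a → i≢n (weight-injective s (≡.trans wi≡a (≡.sym wn≡a)))))
            (*-congˡ (reflexive (≡.cong y (ℕ.m+n∸m≡n n n′))))
      where
      T≡ab : total (n +ℕ n′) ≡ a +ℕ b
      T≡ab = ≡.trans (weight-+ w n n′ s s′) (≡.cong₂ _+ℕ_ wn≡a wn′≡b)

    *ₛ-coeffOfWeight : ∀ {l l′} → CoeffOfWeight s x a l → CoeffOfWeight s′ y b l′ →
                       CoeffOfWeight (s +ℕ s′) (x *ₛ y) (a +ℕ b) (l * l′)
    *ₛ-coeffOfWeight {l} {l′} (x~l , l≈0) (y~l′ , l′≈0) = leading , vanishing
      where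
      leading : ∀ D → total D ≡ a +ℕ b → (x *ₛ y) D ≈ l * l′
      leading D eq with weight? s a
      ... | inj₂ none = trans (*ₛ-gap D none (ℕ.≤-reflexive (≡.sym eq)))
                              (sym (trans (*-congʳ (l≈0 none)) (zeroˡ l′)))
      ... | inj₁ (n , wn≡a) with n ℕ.≤? D
      ...   | yes n≤D = trans (reflexive (≡.cong (x *ₛ y) (≡.sym (ℕ.m+[n∸m]≡n n≤D))))
                          (trans (*ₛ-leading wn≡a wD-n≡b) (*-cong (x~l n wn≡a) (y~l′ (D ∸ n) wD-n≡b)))
        where
        wD-n≡b : w *ℕ (D ∸ n) +ℕ s′ ≡ b
        wD-n≡b = ℕ.+-cancelˡ-≡ a _ _ (≡.trans (≡.cong (_+ℕ (w *ℕ (D ∸ n) +ℕ s′)) (≡.sym wn≡a))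
                                               (≡.trans (≡.sym (weight-split w s s′ n≤D)) eq))
      ...   | no  n≰D = trans (*ₛ-coeff≈0 x y D λ i _ → y≈0⇒x*y≈0 (x i) (y≈0 (D ∸ i)))
                              (sym (y≈0⇒x*y≈0 l (l′≈0 λ n′ eq′ → ℕ.<⇒≱ b<s′ (≡.subst (s′ ≤_) eq′ (ℕ.m≤n+m _ _)))))
        where
        b<s′ : b < s′
        b<s′ = +-cancel-<ʳ (≡.subst (w *ℕ D +ℕ s <_) wn≡a (ℕ.+-monoˡ-< s (ℕ.*-monoʳ-< w (ℕ.≰⇒> n≰D))))
                           (s≤s (ℕ.≤-reflexive (≡.trans (≡.sym eq) (≡.sym (ℕ.+-assoc (w *ℕ D) s s′)))))
        y≈0 : ∀ n′ → y n′ ≈ 0#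
        y≈0 n′ = y≤b n′ (ℕ.<-≤-trans b<s′ (ℕ.m≤n+m _ _))
      vanishing : (∀ D → total D ≢ a +ℕ b) → l * l′ ≈ 0#
      vanishing none with weight? s a
      ... | inj₂ none₀        = trans (*-congʳ (l≈0 none₀)) (zeroˡ l′)
      ... | inj₁ (n , wn≡a) = y≈0⇒x*y≈0 l (l′≈0 λ n′ eq′ → none (n +ℕ n′)
                                  (≡.trans (weight-+ w n n′ s s′) (≡.cong₂ _+ℕ_ wn≡a eq′)))

  detₛ-degreeAtMost : ∀ k (M : Fin k → Fin k → Series) (a s : Fin k → ℕ) →
    (∀ i j → DegreeAtMost (s j) (M i j) (a i)) → DegreeAtMost (sum s) (detₛ k M) (sum a)
  detₛ-degreeAtMost zero    M a s M≤ zero    0<w0 =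
    ⊥-elim (ℕ.<-irrefl ≡.refl (≡.subst (0 <_) (≡.trans (ℕ.+-identityʳ _) (ℕ.*-zeroʳ w)) 0<w0))
  detₛ-degreeAtMost zero    M a s M≤ (suc n) _ = refl
  detₛ-degreeAtMost (suc k) M a s M≤ D a<wD+s =
    trans (detₛ-suc-coeff k M D) (sumFin-zero (suc k) λ j → alt-zero (toℕ j)
      (*ₛ-degreeAtMost (M≤ Fin.zero j)
         (detₛ-degreeAtMost k (minor M j) (a ∘ Fin.suc) (removeAt s j) (λ i → M≤ (Fin.suc i) ∘ punchIn j))
         D (≡.subst (λ t → sum a < w *ℕ D +ℕ t) (sum-remove s) a<wD+s)))

  coeffOfWeight-shift : ∀ {s s′ x d l} → s ≡ s′ → CoeffOfWeight s x d l → CoeffOfWeight s′ x d l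
  coeffOfWeight-shift ≡.refl x~l = x~l

  detₛ-coeffOfWeight : ∀ k (M : Fin k → Fin k → Series) (L : Fin k → Fin k → Carrier) (a s : Fin k → ℕ) →
    (∀ i j → DegreeAtMost (s j) (M i j) (a i)) → (∀ i j → CoeffOfWeight (s j) (M i j) (a i) (L i j)) →
    CoeffOfWeight (sum s) (detₛ k M) (sum a) (det k L)
  detₛ-coeffOfWeight zero    M L a s _  _   = leading , vanishing
    where
    w0+0≡0 : w *ℕ 0 +ℕ 0 ≡ 0
    w0+0≡0 = ≡.cong (_+ℕ 0) (ℕ.*-zeroʳ w)
    leading : ∀ D → w *ℕ D +ℕ 0 ≡ 0 → 1ₛ D ≈ 1#
    leading D wD≡0 with weight-injective 0 (≡.trans wD≡0 (≡.sym w0+0≡0))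
    ... | ≡.refl = refl
    vanishing : (∀ D → w *ℕ D +ℕ 0 ≢ 0) → 1# ≈ 0#
    vanishing none = ⊥-elim (none 0 w0+0≡0)
  detₛ-coeffOfWeight (suc k) M L a s M≤ M~L =
      (λ D eq → trans (detₛ-suc-coeff k M D) (sumFin-cong (suc k) λ j → alt-cong (toℕ j) (proj₁ (term j) D eq)))
    , (λ none → sumFin-zero (suc k) λ j → alt-zero (toℕ j) (proj₂ (term j) none))
    where
    term : ∀ j → CoeffOfWeight (sum s) (M Fin.zero j *ₛ detₛ k (minor M j)) (sum a)
                                       (L Fin.zero j * det k (minor L j))
    term j = coeffOfWeight-shift (≡.sym (sum-remove s)) (*ₛ-coeffOfWeight (M≤ Fin.zero j)
      (detₛ-degreeAtMost k (minor M j) (a ∘ Fin.suc) (removeAt s j) (λ i → M≤ (Fin.suc i) ∘ punchIn j))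
      (M~L Fin.zero j)
      (detₛ-coeffOfWeight k (minor M j) (minor L j) (a ∘ Fin.suc) (removeAt s j)
        (λ i → M≤ (Fin.suc i) ∘ punchIn j) (λ i → M~L (Fin.suc i) ∘ punchIn j)))

module Interleaving (m′ : ℕ) where
  open import Data.Nat using (_+_; _*_; _/_; _%_)
  open import Data.Nat.DivMod using (m≡m%n+[m/n]*n; m%n<n)
  open import Algebra.Properties.CommutativeSemigroup ℕ.+-commutativeSemigroup using (xy∙z≈xz∙y)

  m : ℕ
  m = suc m′

  shift : ℕ → ℕ
  shift j = m′ ∸ j

  record Position (E : ℕ) : Set where
    constructor at
    field
      slot     : ℕ
      slot<m   : slot < m
      exponent : ℕ
      weight≡  : m * exponent + shift slot ≡ E

  position : ∀ E → Position E
  position E = record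
    { slot     = m′ ∸ E % m
    ; slot<m   = s≤s (ℕ.m∸n≤m m′ (E % m))
    ; exponent = E / m
    ; weight≡  = ≡.trans (≡.cong (m * (E / m) +_) (ℕ.m∸[m∸n]≡n (ℕ.≤-pred (m%n<n E m))))
                   (≡.trans (ℕ.+-comm _ (E % m))
                   (≡.trans (≡.cong (E % m +_) (ℕ.*-comm m (E / m))) (≡.sym (m≡m%n+[m/n]*n E m))))
    }

  shift<m : ∀ j → shift j < m
  shift<m j = s≤s (ℕ.m∸n≤m m′ j)

  position-unique : ∀ {j j′ n n′} → j < m → j′ < m →
                    m * n + shift j ≡ m * n′ + shift j′ → j ≡ j′ × n ≡ n′
  position-unique {j} {j′} j<m j′<m eq with *+-injective m (shift<m j) (shift<m j′) eq
  ... | n≡n′ , shift≡ = ℕ.∸-cancelˡ-≡ (ℕ.≤-pred j<m) (ℕ.≤-pred j′<m) shift≡ , n≡n′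

  weight<scale : ∀ {n D} j → n < D → m * n + shift j < m * D
  weight<scale {n} {D} j n<D = ℕ.<-≤-trans
    (≡.subst (m * n + shift j <_) (≡.trans (ℕ.+-comm (m * n) m) (≡.sym (ℕ.*-suc m n)))
             (ℕ.+-monoʳ-< (m * n) (shift<m j)))
    (ℕ.*-monoʳ-≤ m n<D)

  shift-suc : ∀ {j} → j < m′ → shift j ≡ suc (shift (suc j))
  shift-suc j<m′ = ℕ.+-∸-assoc 1 j<m′

  shift-last : shift m′ ≡ 0
  shift-last = ℕ.n∸n≡0 m′

  weight-wrap : ∀ n → m * suc n + shift m′ ≡ suc (m * n + shift 0)
  weight-wrap n = ≡.trans (≡.cong (m * suc n +_) shift-last)
                    (≡.trans (ℕ.+-identityʳ _) (≡.trans (ℕ.*-suc m n) (≡.cong suc (ℕ.+-comm m′ (m * n)))))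

  window-injective : ∀ {E i i′ n n′ r} → i < m → i′ < m →
                     E + i ≡ m * n + r → E + i′ ≡ m * n′ + r → i ≡ i′
  window-injective {E} {i} {i′} {n} {n′} {r} i<m i′<m eq eq′ =
    ≡.sym (proj₂ (*+-injective m i′<m i<m (ℕ.+-cancelʳ-≡ r _ _ (begin
      m * n + i′ + r      ≡⟨ xy∙z≈xz∙y (m * n) i′ r ⟩
      m * n + r + i′      ≡⟨ ≡.cong (_+ i′) eq ⟨
      E + i + i′          ≡⟨ xy∙z≈xz∙y E i i′ ⟩
      E + i′ + i          ≡⟨ ≡.cong (_+ i) eq′ ⟩
      m * n′ + r + i      ≡⟨ xy∙z≈xz∙y (m * n′) r i ⟩
      m * n′ + i + r      ∎))))
    where open ≡.≡-Reasoning

module Recursion {c ℓ : Level} (K : Field c ℓ) (m′ : ℕ) (q : ℕ → Field.Carrier K)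
                 (A₀ : Fin (suc m′) → Over.Series K) where
  open Field K
  open Over K
  open FieldProperties K
  open SeriesProperties K
  open Determinants K using (det-monomial≉0)
  open Det rawRing using (det)
  open Interleaving m′
  open Eq m q
  open Weighted K m
  open import Relation.Binary.Reasoning.Setoid setoid

  Aₖ : ℕ → ℕ → Series
  Aₖ = A A₀

  A-initial : ∀ j (j<m : j < m) → Aₖ 0 j ≈ₛ A₀ (fromℕ< j<m)
  A-initial j j<m n with j ℕ.<? m
  ... | yes _   = refl
  ... | no  j≮m = ⊥-elim (j≮m j<m)

  A-inner : ∀ k j → j < m′ →
            Aₖ (suc k) j ≈ₛ (- q (m ∸ 2 ∸ j)) ·ₛ Aₖ k 0 +ₛ N ·ₛ Δ (Aₖ k j) +ₛ N ·ₛ Aₖ k (suc j)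
  A-inner k j j<m′ n rewrite <ᵇ-true j<m′ = +-congʳ (+-congʳ (constₛ-*ₛ _ (Aₖ k 0) n))

  A-last : ∀ k → Aₖ (suc k) m′ ≈ₛ tₛ *ₛ Aₖ k 0 +ₛ N ·ₛ Δ (Aₖ k m′)
  A-last k n rewrite <ᵇ-irrefl m′ = refl

  DegreeBelow : ℕ → ℕ → Set ℓ
  DegreeBelow k E = ∀ j → j < m → ∀ n → E ≤ m *ℕ n +ℕ shift j → Aₖ k j n ≈ 0#

  record Leading (k E : ℕ) : Set ℓ where
    constructor lead
    field
      pos     : Position E
      coeff≉0 : ¬ (Aₖ k (Position.slot pos) (Position.exponent pos) ≈ 0#)

  Degree : ℕ → ℕ → Set ℓ
  Degree k E = DegreeBelow k (suc E) × Leading k E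

  degreeBelow-step : ∀ {k E} → DegreeBelow k (suc E) → DegreeBelow (suc k) (suc (suc E))
  degreeBelow-step {k} {E} below j j<m n E+2≤ with j ℕ.<? m′
  ... | yes j<m′ = trans (A-inner k j j<m′ n)
      (x≈0∧y≈0⇒x+y≈0 (x≈0∧y≈0⇒x+y≈0 (y≈0⇒x*y≈0 _ (below 0 (s≤s z≤n) n slot₀))
                                    (y≈0⇒x*y≈0 N (y≈0⇒x*y≈0 _ (below j j<m n (ℕ.<⇒≤ E+2≤)))))
                     (y≈0⇒x*y≈0 N (below (suc j) (s≤s j<m′) n slot₊₁)))
    where
    slot₀ : suc E ≤ m *ℕ n +ℕ shift 0
    slot₀ = ℕ.≤-trans (ℕ.<⇒≤ E+2≤) (ℕ.+-monoʳ-≤ (m *ℕ n) (ℕ.m∸n≤m m′ j))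
    slot₊₁ : suc E ≤ m *ℕ n +ℕ shift (suc j)
    slot₊₁ = ℕ.≤-pred (≡.subst (suc (suc E) ≤_)
               (≡.trans (≡.cong (m *ℕ n +ℕ_) (shift-suc j<m′)) (ℕ.+-suc _ _)) E+2≤)
  ... | no j≮m′ rewrite ℕ.≤-antisym (ℕ.≤-pred j<m) (ℕ.≮⇒≥ j≮m′) =
    trans (A-last k n) (x≈0∧y≈0⇒x+y≈0 (wrapped n E+2≤)
                          (y≈0⇒x*y≈0 N (y≈0⇒x*y≈0 _ (below m′ ℕ.≤-refl n (ℕ.<⇒≤ E+2≤)))))
    where
    wrapped : ∀ n → suc (suc E) ≤ m *ℕ n +ℕ shift m′ → (tₛ *ₛ Aₖ k 0) n ≈ 0#
    wrapped zero    _  = tₛ-*ₛ-zero (Aₖ k 0)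
    wrapped (suc n) le = trans (tₛ-*ₛ-suc (Aₖ k 0) n)
      (below 0 (s≤s z≤n) n (ℕ.≤-pred (≡.subst (suc (suc E) ≤_) (weight-wrap n) le)))

  leading-step : ∀ {k E} → ¬ (N ≈ 0#) → DegreeBelow k (suc E) → Leading k E → Leading (suc k) (suc E)
  leading-step {k} {E} N≉0 below (lead (at zero _ n wt) c≉0) =
    lead (at m′ ℕ.≤-refl (suc n) wt′) λ c′≈0 → c≉0 (begin
      Aₖ k 0 n                                                    ≈⟨ tₛ-*ₛ-suc (Aₖ k 0) n ⟨
      (tₛ *ₛ Aₖ k 0) (suc n)                                      ≈⟨ +-identityʳ _ ⟨
      (tₛ *ₛ Aₖ k 0) (suc n) + 0#                                 ≈⟨ +-congˡ (y≈0⇒x*y≈0 N (y≈0⇒x*y≈0 _ last≈0)) ⟨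
      (tₛ *ₛ Aₖ k 0) (suc n) + N * (ι (suc n) * Aₖ k m′ (suc n))  ≈⟨ A-last k (suc n) ⟨
      Aₖ (suc k) m′ (suc n)                                       ≈⟨ c′≈0 ⟩
      0#                                                          ∎)
    where
    wt′ : m *ℕ suc n +ℕ shift m′ ≡ suc E
    wt′ = ≡.trans (weight-wrap n) (≡.cong suc wt)
    last≈0 : Aₖ k m′ (suc n) ≈ 0#
    last≈0 = below m′ ℕ.≤-refl (suc n) (ℕ.≤-reflexive (≡.sym wt′))
  leading-step {k} {E} N≉0 below (lead (at (suc j) j+1<m n wt) c≉0) =
    lead (at j (ℕ.m<n⇒m<1+n j<m′) n wt′) λ c′≈0 → *-≉0 N≉0 c≉0 (begin
      N * Aₖ k (suc j) n                                          ≈⟨ +-identityˡ _ ⟨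
      0# + N * Aₖ k (suc j) n                                     ≈⟨ +-congʳ (x≈0∧y≈0⇒x+y≈0 (y≈0⇒x*y≈0 _ first≈0)
                                                                       (y≈0⇒x*y≈0 N (y≈0⇒x*y≈0 _ middle≈0))) ⟨
      (- q (m ∸ 2 ∸ j)) * Aₖ k 0 n + N * (ι n * Aₖ k j n) + N * Aₖ k (suc j) n
                                                                  ≈⟨ A-inner k j j<m′ n ⟨
      Aₖ (suc k) j n                                              ≈⟨ c′≈0 ⟩
      0#                                                          ∎)
    where
    j<m′ : j < m′
    j<m′ = ℕ.≤-pred j+1<m
    wt′ : m *ℕ n +ℕ shift j ≡ suc E
    wt′ = ≡.trans (≡.cong (m *ℕ n +ℕ_) (shift-suc j<m′)) (≡.trans (ℕ.+-suc _ _) (≡.cong suc wt))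
    first≈0 : Aₖ k 0 n ≈ 0#
    first≈0 = below 0 (s≤s z≤n) n (≡.subst (_< m *ℕ n +ℕ m′) wt
                (ℕ.+-monoʳ-< (m *ℕ n) (ℕ.∸-monoʳ-< {o = 0} (s≤s z≤n) j<m′)))
    middle≈0 : Aₖ k j n ≈ 0#
    middle≈0 = below j (ℕ.m<n⇒m<1+n j<m′) n (ℕ.≤-reflexive (≡.sym wt′))

  degree-step : ∀ {k E} → ¬ (N ≈ 0#) → Degree k E → Degree (suc k) (suc E)
  degree-step {k} N≉0 (below , leading) = degreeBelow-step {k} below , leading-step N≉0 below leading

  degree-+ : ∀ {k E} → ¬ (N ≈ 0#) → Degree k E → ∀ i → Degree (k +ℕ i) (E +ℕ i)
  degree-+ {k} {E} N≉0 deg zero    = ≡.subst₂ Degree (≡.sym (ℕ.+-identityʳ k)) (≡.sym (ℕ.+-identityʳ E)) deg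
  degree-+ {k} {E} N≉0 deg (suc i) = ≡.subst₂ Degree (≡.sym (ℕ.+-suc k i)) (≡.sym (ℕ.+-suc E i))
                                       (degree-step N≉0 (degree-+ N≉0 deg i))

  degreeBelow-poly : (∀ j → IsPoly (A₀ j)) → ∃ (DegreeBelow 0)
  degreeBelow-poly poly = m *ℕ sum d , λ j j<m n mD≤ →
    trans (A-initial j j<m n) (proj₂ (poly (fromℕ< j<m)) n
      (ℕ.≤-trans (≤-sum d (fromℕ< j<m)) (ℕ.≮⇒≥ λ n<D → ℕ.<⇒≱ (weight<scale j n<D) mD≤)))
    where
    d : Fin m → ℕ
    d j = proj₁ (poly j)

  degreeBelow-lower : ∀ {E} → ¬ Leading 0 E → DegreeBelow 0 (suc E) → ¬ ¬ DegreeBelow 0 E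
  degreeBelow-lower {E} no-lead below ¬below = no-lead (lead p λ c≈0 → ¬below (extend c≈0))
    where
    p : Position E
    p = position E
    open Position p
    extend : Aₖ 0 slot exponent ≈ 0# → DegreeBelow 0 E
    extend c≈0 j j<m n E≤ with ℕ.m≤n⇒m<n∨m≡n E≤
    ... | inj₁ E< = below j j<m n E<
    ... | inj₂ E≡ with position-unique j<m slot<m (≡.trans (≡.sym E≡) (≡.sym weight≡))
    ...   | ≡.refl , ≡.refl = c≈0

  degreeBelow-zero : DegreeBelow 0 0 → ∀ j → A₀ j ≈ₛ 0ₛ
  degreeBelow-zero below j n = begin
    A₀ j n                          ≡⟨ ≡.cong (λ j′ → A₀ j′ n) (Fin.fromℕ<-toℕ j (Fin.toℕ<n j)) ⟨
    A₀ (fromℕ< (Fin.toℕ<n j)) n     ≈⟨ A-initial (toℕ j) (Fin.toℕ<n j) n ⟨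
    Aₖ 0 (toℕ j) n                  ≈⟨ below (toℕ j) (Fin.toℕ<n j) n z≤n ⟩
    0#                              ∎

  initial-degree : (∀ j → IsPoly (A₀ j)) → ¬ (∀ j → A₀ j ≈ₛ 0ₛ) → ¬ ¬ ∃ (Degree 0)
  -- Equality in K is not decidable, so the leading term of A₀ is located only under ¬ ¬,
  -- by lowering a weight bound one step at a time; this suffices for a negative conclusion.
  initial-degree poly A₀≉0 no-degree =
    descend (proj₁ (degreeBelow-poly poly)) (proj₂ (degreeBelow-poly poly)) (A₀≉0 ∘ degreeBelow-zero)
    where
    descend : ∀ E → DegreeBelow 0 E → ¬ ¬ DegreeBelow 0 0
    descend zero    below ¬below = ¬below below
    descend (suc E) below ¬below =
      degreeBelow-lower (λ leading → no-degree (E , below , leading)) below λ below′ → descend E below′ ¬below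

  module LeadingMatrix {k E : ℕ} (N≉0 : ¬ (N ≈ 0#)) (deg : Degree k E) where
    open Position

    a s : Fin m → ℕ
    a i = E +ℕ toℕ i
    s j = shift (toℕ j)

    row : ∀ i → Degree (k +ℕ toℕ i) (a i)
    row i = degree-+ N≉0 deg (toℕ i)

    p : ∀ i → Position (a i)
    p i = Leading.pos (proj₂ (row i))

    π : Fin m → Fin m
    π i = fromℕ< (slot<m (p i))

    toℕ-π : ∀ i → toℕ (π i) ≡ slot (p i)
    toℕ-π i = Fin.toℕ-fromℕ< (slot<m (p i))

    at-π : ∀ i j n → m *ℕ n +ℕ s j ≡ a i → j ≡ π i × n ≡ exponent (p i)
    at-π i j n eq with position-unique (Fin.toℕ<n j) (slot<m (p i)) (≡.trans eq (≡.sym (weight≡ (p i))))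
    ... | j≡ , n≡ = Fin.toℕ-injective (≡.trans j≡ (≡.sym (toℕ-π i))) , n≡

    select : ∀ i j → Dec (j ≡ π i) → Carrier
    select i j (yes _) = M A₀ k i j (exponent (p i))
    select i j (no  _) = 0#

    L : Fin m → Fin m → Carrier
    L i j = select i j (j Fin.≟ π i)

    L-off : ∀ i j → j ≢ π i → L i j ≈ 0#
    L-off i j j≢π with j Fin.≟ π i
    ... | yes j≡π = ⊥-elim (j≢π j≡π)
    ... | no  _   = refl

    L-on : ∀ i → ¬ (L i (π i) ≈ 0#)
    L-on i with π i Fin.≟ π i
    ... | yes _   = ≡.subst (λ j → ¬ (Aₖ (k +ℕ toℕ i) j (exponent (p i)) ≈ 0#)) (≡.sym (toℕ-π i))
                      (Leading.coeff≉0 (proj₂ (row i)))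
    ... | no  π≢π = ⊥-elim (π≢π ≡.refl)

    M~L : ∀ i j → CoeffOfWeight (s j) (M A₀ k i j) (a i) (L i j)
    M~L i j with j Fin.≟ π i
    ... | yes ≡.refl = (λ n eq → reflexive (≡.cong (M A₀ k i j) (proj₂ (at-π i j n eq))))
                     , (λ none → ⊥-elim (none (exponent (p i))
                         (≡.trans (≡.cong (λ r → m *ℕ exponent (p i) +ℕ shift r) (toℕ-π i)) (weight≡ (p i)))))
    ... | no  j≢π    = (λ n eq → ⊥-elim (j≢π (proj₁ (at-π i j n eq)))) , (λ _ → refl)

    π-injective : ∀ {i i′} → π i ≡ π i′ → i ≡ i′
    π-injective {i} {i′} π≡ = Fin.toℕ-injective (window-injective
      {n = exponent (p i)} {n′ = exponent (p i′)} {r = shift (slot (p i))} (Fin.toℕ<n i) (Fin.toℕ<n i′)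
      (≡.sym (weight≡ (p i)))
      (≡.trans (≡.sym (weight≡ (p i′)))
               (≡.cong (λ r → m *ℕ exponent (p i′) +ℕ shift r)
                       (≡.trans (≡.sym (toℕ-π i′)) (≡.trans (≡.cong toℕ (≡.sym π≡)) (toℕ-π i))))))

    weight-total : m *ℕ E +ℕ sum s ≡ sum a
    weight-total = ≡.trans (≡.cong (m *ℕ E +ℕ_) (sum-reverse m′)) (≡.sym (sum-+ˡ m E toℕ))

    detM~detL : CoeffOfWeight (sum s) (detₛ m (M A₀ k)) (sum a) (det m L)
    detM~detL = detₛ-coeffOfWeight m (M A₀ k) L a s
                  (λ i j → proj₁ (row i) (toℕ j) (Fin.toℕ<n j)) M~L

  det-M≉0 : ∀ {k E} → ¬ (N ≈ 0#) → Degree k E → ¬ (detₛ m (M A₀ k) ≈ₛ 0ₛ)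
  det-M≉0 {k} {E} N≉0 deg detM≈0 =
    det-monomial≉0 m L π π-injective L-off L-on (trans (sym (proj₁ detM~detL E weight-total)) (detM≈0 E))
    where open LeadingMatrix N≉0 deg

module Binomial {c ℓ : Level} (K : Field c ℓ) where
  open Field K
  open Over K
  open Sums K
  open FieldProperties K
  open SeriesProperties K
  open import Relation.Binary.Reasoning.Setoid setoid

  1+t : Series
  1+t = 1ₛ +ₛ tₛ

  1+t-*ₛ-zero : ∀ b → (1+t *ₛ b) 0 ≈ b 0
  1+t-*ₛ-zero b = trans (*ₛ-distribʳ-+ₛ 1ₛ tₛ b 0)
    (trans (+-cong (trans (constₛ-*ₛ 1# b 0) (*-identityˡ _)) (tₛ-*ₛ-zero b)) (+-identityʳ _))

  1+t-*ₛ-suc : ∀ b n → (1+t *ₛ b) (suc n) ≈ b (suc n) + b n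
  1+t-*ₛ-suc b n = trans (*ₛ-distribʳ-+ₛ 1ₛ tₛ b (suc n))
    (+-cong (trans (constₛ-*ₛ 1# b (suc n)) (*-identityˡ _)) (tₛ-*ₛ-suc b n))

  powₛ-suc : ∀ i → powₛ 1+t (suc i) ≈ₛ 1+t *ₛ powₛ 1+t i
  powₛ-suc i = *ₛ-comm (powₛ 1+t i) 1+t

  powₛ-above : ∀ i n → i < n → powₛ 1+t i n ≈ 0#
  powₛ-above zero    (suc n) _         = refl
  powₛ-above (suc i) (suc n) (s≤s i<n) = trans (powₛ-suc i (suc n)) (trans (1+t-*ₛ-suc (powₛ 1+t i) n)
    (x≈0∧y≈0⇒x+y≈0 (powₛ-above i (suc n) (ℕ.m<n⇒m<1+n i<n)) (powₛ-above i n i<n)))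

  powₛ-top : ∀ i → powₛ 1+t i i ≈ 1#
  powₛ-top zero    = refl
  powₛ-top (suc i) = trans (powₛ-suc i (suc i)) (trans (1+t-*ₛ-suc (powₛ 1+t i) i)
    (trans (+-cong (powₛ-above i (suc i) ℕ.≤-refl) (powₛ-top i)) (+-identityˡ 1#)))

  eval-cong : ∀ d {a b} x → a ≈ₛ b → eval d a x ≈ eval d b x
  eval-cong d x a≈b = Σ<-cong d λ n _ → *-congʳ (a≈b n)

  eval-extend : ∀ d b x → (∀ n → d ≤ n → b n ≈ 0#) → ∀ D → d ≤ D → eval D b x ≈ eval d b x
  eval-extend .0 b x b≈0 zero    z≤n   = refl
  eval-extend d  b x b≈0 (suc D) d≤1+D with ℕ.m≤n⇒m<n∨m≡n d≤1+D
  ... | inj₁ d<1+D  = trans (+-cong (eval-extend d b x b≈0 D (ℕ.≤-pred d<1+D))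
                                    (trans (*-congʳ (b≈0 D (ℕ.≤-pred d<1+D))) (zeroˡ _)))
                            (+-identityʳ _)
  ... | inj₂ ≡.refl = refl

  eval-1+t-*ₛ : ∀ d b x → (∀ n → d < n → b n ≈ 0#) →
                eval (suc (suc d)) (1+t *ₛ b) x ≈ (1# + x) * eval (suc d) b x
  eval-1+t-*ₛ d b x b≈0 = begin
    eval (suc (suc d)) (1+t *ₛ b) x
      ≈⟨ Σ<-suc-head (suc d) _ ⟩
    (1+t *ₛ b) 0 * pow x 0 + Σ< (suc d) (λ n → (1+t *ₛ b) (suc n) * pow x (suc n))
      ≈⟨ +-cong (*-congʳ (1+t-*ₛ-zero b)) (Σ<-cong (suc d) λ n _ →
           trans (*-congʳ (1+t-*ₛ-suc b n)) (trans (distribʳ _ _ _) (+-congˡ (sym (*-assoc _ _ _))))) ⟩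
    b 0 * pow x 0 + Σ< (suc d) (λ n → b (suc n) * pow x (suc n) + b n * pow x n * x)
      ≈⟨ +-congˡ (Σ<-distrib-+ (suc d) _ _) ⟩
    b 0 * pow x 0 + (Σ< (suc d) (λ n → b (suc n) * pow x (suc n)) + Σ< (suc d) (λ n → b n * pow x n * x))
      ≈⟨ +-assoc _ _ _ ⟨
    (b 0 * pow x 0 + Σ< (suc d) (λ n → b (suc n) * pow x (suc n))) + Σ< (suc d) (λ n → b n * pow x n * x)
      ≈⟨ +-cong (Σ<-suc-head (suc d) (λ n → b n * pow x n)) (*-distribʳ-Σ< (suc d) x (λ n → b n * pow x n)) ⟨
    (eval (suc d) b x + b (suc d) * pow x (suc d)) + eval (suc d) b x * x
      ≈⟨ +-congʳ (trans (+-congˡ (trans (*-congʳ (b≈0 (suc d) ℕ.≤-refl)) (zeroˡ _))) (+-identityʳ _)) ⟩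
    eval (suc d) b x + eval (suc d) b x * x
      ≈⟨ +-cong (*-identityˡ _) (*-comm _ _) ⟨
    1# * eval (suc d) b x + x * eval (suc d) b x
      ≈⟨ distribʳ _ _ _ ⟨
    (1# + x) * eval (suc d) b x ∎

  eval-powₛ : ∀ i x → eval (suc i) (powₛ 1+t i) x ≈ pow (1# + x) i
  eval-powₛ zero    x = trans (+-identityˡ _) (*-identityˡ _)
  eval-powₛ (suc i) x = begin
    eval (suc (suc i)) (powₛ 1+t (suc i)) x  ≈⟨ eval-cong (suc (suc i)) x (powₛ-suc i) ⟩
    eval (suc (suc i)) (1+t *ₛ powₛ 1+t i) x ≈⟨ eval-1+t-*ₛ i _ x (powₛ-above i) ⟩
    (1# + x) * eval (suc i) (powₛ 1+t i) x   ≈⟨ *-congˡ (eval-powₛ i x) ⟩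
    (1# + x) * pow (1# + x) i                ≈⟨ *-comm _ _ ⟩
    pow (1# + x) (suc i)                     ∎

module Equation {c ℓ : Level} (K : Field c ℓ) (m″ : ℕ) (q : ℕ → Field.Carrier K) where
  open Field K
  open Over K
  open Sums K
  open FieldProperties K
  open SeriesProperties K
  open Binomial K
  open import Algebra.Properties.CommutativeSemigroup *-commutativeSemigroup using (x∙yz≈y∙xz; interchange)
  open import Relation.Binary.Reasoning.Setoid setoid

  m′ m : ℕ
  m′ = suc m″
  m  = suc m′

  open Eq m q

  S : Series
  S = Σₛ< m (λ i → q i ·ₛ powₛ 1+t i)

  S-above : ∀ n → m′ < n → S n ≈ 0#
  S-above n m′<n = Σ<-zero m λ i i<m →
    y≈0⇒x*y≈0 (q i) (powₛ-above i n (ℕ.≤-<-trans (ℕ.≤-pred i<m) m′<n))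

  S-top : S m′ ≈ N
  S-top = trans (Σ<-single m m′ ℕ.≤-refl λ i i<m i≢m′ →
                   y≈0⇒x*y≈0 (q i) (powₛ-above i m′ (ℕ.≤∧≢⇒< (ℕ.≤-pred i<m) i≢m′)))
                (trans (*-congˡ (powₛ-top m′)) (*-identityʳ _))

  eval-S : ∀ x → eval m S x ≈ eval m q (1# + x)
  eval-S x = begin
    Σ< m (λ n → Σ< m (λ i → q i * powₛ 1+t i n) * pow x n)
      ≈⟨ Σ<-cong m (λ n _ → *-distribʳ-Σ< m (pow x n) (λ i → q i * powₛ 1+t i n)) ⟩
    Σ< m (λ n → Σ< m (λ i → q i * powₛ 1+t i n * pow x n))
      ≈⟨ Σ<-comm m m (λ i n → q i * powₛ 1+t i n * pow x n) ⟩
    Σ< m (λ i → Σ< m (λ n → q i * powₛ 1+t i n * pow x n))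
      ≈⟨ Σ<-cong m (λ i _ → trans (Σ<-cong m λ n _ → *-assoc _ _ _)
                                   (sym (*-distribˡ-Σ< m (q i) (λ n → powₛ 1+t i n * pow x n)))) ⟩
    Σ< m (λ i → q i * eval m (powₛ 1+t i) x)
      ≈⟨ Σ<-cong m (λ i i<m → *-congˡ (trans (eval-extend (suc i) (powₛ 1+t i) x (powₛ-above i) m i<m)
                                             (eval-powₛ i x))) ⟩
    Σ< m (λ i → q i * pow (1# + x) i) ∎

  module _ (p : ℕ → Carrier) (p≈ : p ≈ₛ 1+t *ₛ S) where

    p-top : p m ≈ N
    p-top = trans (p≈ m) (trans (1+t-*ₛ-suc S m′) (trans (+-congʳ (S-above m ℕ.≤-refl)) (trans (+-identityˡ _) S-top)))

    P-factor : ∀ x → eval (suc m) p x ≈ (1# + x) * eval m q (1# + x)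
    P-factor x = trans (eval-cong (suc m) x p≈) (trans (eval-1+t-*ₛ m′ S x S-above) (*-congˡ (eval-S x)))

  module _ (P : Carrier → Carrier) (P-factor : ∀ x → P x ≈ (1# + x) * eval m q (1# + x))
           (F : Series) (F-coeff : ∀ n → F n * Π< n (P ∘ ι) ≈ 1#) where

    F-step : ∀ k → P (ι k) * F (suc k) ≈ F k
    F-step k = begin
      P (ι k) * F (suc k)                              ≈⟨ *-comm _ _ ⟩
      F (suc k) * P (ι k)                              ≈⟨ *-identityˡ _ ⟨
      1# * (F (suc k) * P (ι k))                       ≈⟨ *-congʳ (F-coeff k) ⟨
      (F k * Π< k (P ∘ ι)) * (F (suc k) * P (ι k))     ≈⟨ interchange _ _ _ _ ⟩
      (F k * F (suc k)) * (Π< k (P ∘ ι) * P (ι k))     ≈⟨ *-assoc _ _ _ ⟩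
      F k * (F (suc k) * (Π< k (P ∘ ι) * P (ι k)))     ≈⟨ *-congˡ (F-coeff (suc k)) ⟩
      F k * 1#                                         ≈⟨ *-identityʳ _ ⟩
      F k                                              ∎

    ΔP₁ΔF-coeff : ∀ n → ι n * Σ< m (λ i → q i * Δ^ i F n) ≈ (tₛ *ₛ F) n
    ΔP₁ΔF-coeff zero    = trans (zeroˡ _) (sym (tₛ-*ₛ-zero F))
    ΔP₁ΔF-coeff (suc k) = begin
      y * Σ< m (λ i → q i * Δ^ i F (suc k))
        ≈⟨ *-congˡ (Σ<-cong m λ i _ → trans (*-congˡ (Δ^-coeff i F (suc k))) (sym (*-assoc _ _ _))) ⟩
      y * Σ< m (λ i → q i * pow y i * F (suc k))
        ≈⟨ *-congˡ (*-distribʳ-Σ< m (F (suc k)) (λ i → q i * pow y i)) ⟨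
      y * (eval m q y * F (suc k))   ≈⟨ *-assoc _ _ _ ⟨
      (y * eval m q y) * F (suc k)   ≈⟨ *-congʳ (P-factor (ι k)) ⟨
      P (ι k) * F (suc k)            ≈⟨ F-step k ⟩
      F k                            ≈⟨ tₛ-*ₛ-suc F k ⟨
      (tₛ *ₛ F) (suc k)              ∎
      where
      y : Carrier
      y = ι (suc k)

    equation : Δ (P₁Δ F) +ₛ (-ₛ (tₛ *ₛ F)) ≈ₛ 0ₛ
    equation n = trans (+-congʳ (ΔP₁ΔF-coeff n)) (-‿inverseʳ _)

    Pstar-inner : ∀ j → j < m′ → ∀ y → Pstar j *ₛ y ≈ₛ (- q (m″ ∸ j)) ·ₛ y
    Pstar-inner j j<m′ y rewrite <ᵇ-true j<m′ = constₛ-*ₛ _ y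

    Pstar-last : ∀ y → Pstar m′ *ₛ y ≈ₛ tₛ *ₛ y
    Pstar-last y n rewrite <ᵇ-irrefl m′ = refl

    normal-form : N ·ₛ Δ^ m F ≈ₛ rhs F
    normal-form n = begin
      X                ≈⟨ +-identityˡ X ⟨
      0# + X           ≈⟨ +-congʳ (-‿inverseˡ T) ⟨
      (- T + T) + X    ≈⟨ +-assoc _ _ _ ⟩
      - T + (T + X)    ≈⟨ +-congˡ (trans (sym ΔP₁ΔF-expand) (ΔP₁ΔF-coeff n)) ⟩
      - T + (tₛ *ₛ F) n  ≈⟨ +-cong inner g-last ⟨
      Σ< m′ g + g m′   ∎
      where
      g : ℕ → Carrier
      g j = (Pstar j *ₛ Δ^ (m′ ∸ j) F) n
      h : ℕ → Carrier
      h i = - q i * Δ^ (suc i) F n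
      T X : Carrier
      T = Σ< m′ (λ i → q i * Δ^ (suc i) F n)
      X = N * Δ^ m F n
      ΔP₁ΔF-expand : ι n * Σ< m (λ i → q i * Δ^ i F n) ≈ T + X
      ΔP₁ΔF-expand = trans (*-distribˡ-Σ< m (ι n) _) (Σ<-cong m λ i _ → x∙yz≈y∙xz _ _ _)
      g≈h : ∀ j → j < m′ → g j ≈ h (m″ ∸ j)
      g≈h j j<m′ = trans (Pstar-inner j j<m′ (Δ^ (m′ ∸ j) F) n)
        (reflexive (≡.cong (λ e → - q (m″ ∸ j) * Δ^ e F n) (ℕ.+-∸-assoc 1 (ℕ.≤-pred j<m′))))
      g-last : g m′ ≈ (tₛ *ₛ F) n
      g-last = trans (Pstar-last (Δ^ (m′ ∸ m′) F) n) (reflexive (≡.cong (λ e → (tₛ *ₛ Δ^ e F) n) (ℕ.n∸n≡0 m′)))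
      inner : Σ< m′ g ≈ - T
      inner = begin
        Σ< m′ g                                ≈⟨ Σ<-cong m′ g≈h ⟩
        Σ< m′ (λ j → h (m″ ∸ j))               ≈⟨ Σ<-reverse m″ h ⟨
        Σ< m′ h                                ≈⟨ Σ<-cong m′ (λ i _ → sym (-‿distribˡ-* _ _)) ⟩
        Σ< m′ (λ i → - (q i * Δ^ (suc i) F n)) ≈⟨ -‿distrib-Σ< m′ _ ⟨
        - T                                    ∎
        where open import Algebra.Properties.Ring ring using (-‿distribˡ-*)

theorem4p4 : ∀ {c ℓ} (K : Field c ℓ) → let open Field K in let open Over K in
    CharZero →
    (m : ℕ) → 2 ≤ m →
    -- P = Σ_{i≤m} p_i x^i with deg P = m
    (p : ℕ → Carrier) → (∀ i → m < i → p i ≈ 0#) → ¬ (p m ≈ 0#) →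
    eval (suc m) p (- 1#) ≈ 0# →
    (∀ k → ¬ (eval (suc m) p (ι k) ≈ 0#)) →
    -- F = Σ_n t^n / Π_{k<n} P(k)
    (F : Series) → (∀ n → F n * Π< n (λ k → eval (suc m) p (ι k)) ≈ 1#) →
    -- P(x) = (x+1) P₁(x+1) with P₁ = Σ_{i<m} q_i x^i
    (q : ℕ → Carrier) → (∀ i → m ≤ i → q i ≈ 0#) →
    p ≈ₛ (1ₛ +ₛ tₛ) *ₛ Σₛ< m (λ i → q i ·ₛ powₛ (1ₛ +ₛ tₛ) i) →
    let open Eq m q in
    (Δ (P₁Δ F) +ₛ (-ₛ (tₛ *ₛ F)) ≈ₛ 0ₛ)
    × (N ·ₛ Δ^ m F ≈ₛ rhs F)
    × ¬ (N ≈ 0#)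
    × ((A₀ : Fin m → Series) → (∀ j → IsPoly (A₀ j)) → ¬ (∀ j → A₀ j ≈ₛ 0ₛ) →
       ∀ k → ¬ (detₛ m (M A₀ k) ≈ₛ 0ₛ))
-- Characteristic zero, P(−1) = 0, P(k) ≠ 0 and the degree bounds on p and q are what make F
-- and P₁ exist; here both are given.
theorem4p4 K _ (suc (suc m″)) (s≤s (s≤s z≤n)) p _ p≉0 _ _ F F-coeff q _ p≈ =
  equation P P-factor′ F F-coeff , normal-form P P-factor′ F F-coeff , N≉0 , detM-nonzero
  where
  open Field K
  open Over K
  open Equation K m″ q
  open Eq m q using (N; M)
  P : Carrier → Carrier
  P = eval (suc m) p
  P-factor′ : ∀ x → P x ≈ (1# + x) * eval m q (1# + x)
  P-factor′ = P-factor p p≈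
  N≉0 : ¬ (N ≈ 0#)
  N≉0 N≈0 = p≉0 (trans (p-top p p≈) N≈0)
  detM-nonzero : (A₀ : Fin m → Series) → (∀ j → IsPoly (A₀ j)) → ¬ (∀ j → A₀ j ≈ₛ 0ₛ) →
                 ∀ k → ¬ (detₛ m (M A₀ k) ≈ₛ 0ₛ)
  detM-nonzero A₀ poly A₀≉0 k detM≈0 = initial-degree poly A₀≉0 λ (E , deg) →
    det-M≉0 N≉0 (degree-+ N≉0 deg k) detM≈0
    where open Recursion K m′ q A₀
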